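{- Let $t \geq 1$ be an integer and $\delta > 0$, and let $G$ be a finite graph that is $\mathscr{C}_{2t+5}$-free and has minimum degree at least $\delta |G|$. Then $G$ is homomorphic to a $\mathscr{C}_{2t+1}$-free graph $\Gamma$ with $|\Gamma| \leq (t+1)^{2/\delta}$.
   Context: For an integer $s\ge 1$, $\mathscr{C}_{2s+1}$ denotes the family $\{C_3, C_5, \dots, C_{2s+1}\}$ of odd cycles of length at most $2s+1$; a graph is $\mathscr{C}_{2s+1}$-free if it contains none of these cycles as a subgraph (equivalently, it has odd girth at least $2s+3$). $|G|$ denotes the number of vertices of $G$. A graph $G$ is homomorphic to $\Gamma$ if there is a map $V(G)\to V(\Gamma)$ sending edges to edges.
   Formalization: The parameter δ ranges over the positive rationals. -}

module Defs where

open import Data.Nat using (ℕ; zero; suc; _+_; _*_; _^_; _≤_)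
open import Data.Bool using (Bool; true; false; if_then_else_)
open import Data.Fin using (Fin; zero; suc; inject₁; fromℕ)
open import Data.List using (List; map; allFin)
open import Data.Nat.ListAction using (sum)
open import Data.Empty using (⊥)
open import Data.Product using (Σ; ∃; ∃-syntax; _×_)
open import Relation.Binary.PropositionalEquality using (_≡_)
open import Relation.Nullary using (¬_)
open import Function.Definitions using (Injective)

record Graph (n : ℕ) : Set where
  field
    adj    : Fin n → Fin n → Bool
    sym    : ∀ i j → adj i j ≡ adj j i
    irrefl : ∀ i → adj i i ≡ false

open Graph public

Adj : ∀ {n} → Graph n → Fin n → Fin n → Set
Adj G i j = adj G i j ≡ true

degree : ∀ {n} → Graph n → Fin n → ℕ
degree {n} G v = sum (map (λ j → if adj G v j then 1 else 0) (allFin n))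

-- G contains a cycle of length (suc m) as a subgraph: an injective
-- sequence of vertices f 0, ..., f m with consecutive ones adjacent and
-- f m adjacent to f 0.  (Meaningful as a cycle for suc m ≥ 3.)
ContainsCycle : ∀ {n} → Graph n → ℕ → Set
ContainsCycle {n} G zero = ⊥
ContainsCycle {n} G (suc m) =
  Σ (Fin (suc m) → Fin n) λ f →
    Injective _≡_ _≡_ f
    × (∀ (i : Fin m) → Adj G (f (inject₁ i)) (f (suc i)))
    × Adj G (f (fromℕ m)) (f zero)

OddCycleFree : ℕ → ∀ {n} → Graph n → Set
OddCycleFree s G = ∀ j → 1 ≤ j → j ≤ s → ¬ ContainsCycle G (suc (2 * j))

Homomorphic : ∀ {n m} → Graph n → Graph m → Set
Homomorphic {n} {m} G Γ =
  Σ (Fin n → Fin m) λ φ → ∀ i j → Adj G i j → Adj Γ (φ i) (φ j)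

-- Choose greedily centres x₁, …, x_k pairwise at distance at least 3. Their
-- neighbourhoods are disjoint, so k · δn ≤ n, i.e. k ≤ 1/δ, and by maximality every vertex is
-- within distance 2 of some centre. Map a vertex u to the vector (|d(xᵢ, u) − 1|)ᵢ, distances
-- truncated at t + 3, so every coordinate lies in {0, …, t + 2} and some coordinate is ≤ 1.
-- Two adjacent vertices at the same distance d ≤ t + 2 from a centre would close an odd walk of
-- length 2d + 1 ≤ 2t + 5, so along an edge every coordinate changes by exactly 1 unless both
-- ends sit at the cap t + 2. Let Γ be the graph on such vectors with a coordinate ≤ 1, adjacent
-- when every coordinate moves in this way. Following a coordinate that is ≤ 1 at its start, an
-- odd closed walk of length ≤ 2t + 1 in Γ can never reach the cap, so that coordinate changes
-- by ±1 at every step: impossible for odd length. Finally (t + 3)ᵏ ≤ ((t + 1)²)^(1/δ).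

module Submission where

open import Defs hiding (sym)

open import Data.Bool using (true; false; if_then_else_)
import Data.Bool.Properties as Boolₚ
open import Data.Empty using (⊥; ⊥-elim)
open import Data.Fin as Fin using (Fin; zero; suc; toℕ; fromℕ; inject₁; fromℕ<; finToFun; funToFin)
import Data.Fin.Properties as Finₚ
open import Data.List as List using (List; []; _∷_; length; allFin; lookup)
open import Data.List.Membership.Propositional using (_∈_)
open import Data.List.Membership.Propositional.Properties using (∈-allFin)
open import Data.List.Properties using (length-tabulate)
open import Data.List.Relation.Unary.All as All using (All; []; _∷_)
open import Data.List.Relation.Unary.All.Properties using (¬Any⇒All¬)
open import Data.List.Relation.Unary.AllPairs as AllPairs using (AllPairs; []; _∷_)
open import Data.List.Relation.Unary.Any as Any using (Any; here; there)
open import Data.List.Relation.Unary.Any.Properties using (lookup-index)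
open import Data.Nat using (ℕ; zero; suc; _+_; _*_; _^_; _∸_; _≤_; _<_; z≤n; s≤s; _≤?_; _≟_; ∣_-_∣; parity)
open import Data.Nat.DivMod using (_mod_; m<n⇒m%n≡m; n%n≡0)
open import Data.Nat.Induction using (<-rec)
open import Data.Nat.ListAction using (sum)
open import Data.Nat.Properties
open import Algebra.Properties.CommutativeSemigroup +-commutativeSemigroup
  using () renaming (interchange to +-interchange)
open import Data.Parity.Base as ℙ using (0ℙ; 1ℙ)
import Data.Parity.Properties as ℙₚ
open import Data.Product using (Σ; ∃; ∃₂; ∃-syntax; _×_; _,_; proj₁; proj₂)
open import Data.Sum using (_⊎_; inj₁; inj₂)
open import Function using (_∘_; id)
open import Function.Bundles using (mk⇔)
open import Function.Definitions using (Injective)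
open import Relation.Binary.Definitions using (DecidableEquality; Symmetric; tri<; tri≈; tri>)
open import Relation.Binary.PropositionalEquality
open import Relation.Nullary using (¬_; Dec; yes; no; contradiction)
open import Relation.Nullary.Decidable using (map′; _×-dec_; does; does-⇔; dec-true; dec-false)
open import Relation.Unary using (Decidable)

parity-suc : ∀ n → parity (suc n) ≡ parity n ℙ.⁻¹
parity-suc = ℙₚ.+-homo-+ 1

parity-2*+1 : ∀ j → parity (suc (2 * j)) ≡ 1ℙ
parity-2*+1 j = trans (parity-suc (2 * j)) (cong ℙ._⁻¹ (ℙₚ.*-homo-* 2 j))

parity≡1⇒2*+1 : ∀ {n} → parity n ≡ 1ℙ → ∃[ j ] n ≡ suc (2 * j)
parity≡1⇒2*+1 {suc zero} _ = 0 , refl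
parity≡1⇒2*+1 {suc (suc n)} odd with parity≡1⇒2*+1 {n} odd
... | j , refl = suc j , cong suc (sym (*-suc 2 j))

parity-+-odd : ∀ m n → parity (m + n) ≡ 1ℙ → parity m ≡ 1ℙ ⊎ parity n ≡ 1ℙ
parity-+-odd m n odd with parity m in eq
... | 1ℙ = inj₁ refl
... | 0ℙ = inj₂ (trans (cong (ℙ._+ parity n) (sym eq)) (trans (sym (ℙₚ.+-homo-+ m n)) odd))

-- least P? C is the least d < C with P d, and C if there is none.

least : {P : ℕ → Set} → Decidable P → ℕ → ℕ
least P? zero = zero
least P? (suc C) with P? zero
... | yes _ = zero
... | no _ = suc (least (P? ∘ suc) C)

least-≤-bound : {P : ℕ → Set} (P? : Decidable P) (C : ℕ) → least P? C ≤ C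
least-≤-bound P? zero = z≤n
least-≤-bound P? (suc C) with P? zero
... | yes _ = z≤n
... | no _ = s≤s (least-≤-bound (P? ∘ suc) C)

least-holds : {P : ℕ → Set} (P? : Decidable P) (C : ℕ) → least P? C < C → P (least P? C)
least-holds P? (suc C) lt with P? zero
... | yes p = p
... | no _ = least-holds (P? ∘ suc) C (≤-pred lt)

least-≤ : {P : ℕ → Set} (P? : Decidable P) (C : ℕ) {d : ℕ} → P d → least P? C ≤ d
least-≤ P? zero p = z≤n
least-≤ P? (suc C) {d} p with P? zero
least-≤ P? (suc C) {d} p | yes _ = z≤n
least-≤ P? (suc C) {zero} p | no ¬p = contradiction p ¬p
least-≤ P? (suc C) {suc d} p | no _ = s≤s (least-≤ (P? ∘ suc) C p)

injective⊎repeat : ∀ {m} {A : Set} → DecidableEquality A → (f : Fin m → A) →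
                   Injective _≡_ _≡_ f ⊎ ∃₂ λ i j → i Fin.< j × f i ≡ f j
injective⊎repeat _≟ᴬ_ f with Finₚ.any? (λ i → Finₚ.any? (λ j → (i Finₚ.<? j) ×-dec (f i ≟ᴬ f j)))
... | yes (i , j , i<j , fi≡fj) = inj₂ (i , j , i<j , fi≡fj)
... | no noRepeat = inj₁ injective
  where
  injective : Injective _≡_ _≡_ f
  injective {i} {j} fi≡fj with Finₚ.<-cmp i j
  ... | tri< i<j _ _ = contradiction (i , j , i<j , fi≡fj) noRepeat
  ... | tri≈ _ i≡j _ = i≡j
  ... | tri> _ _ j<i = contradiction (j , i , j<i , sym fi≡fj) noRepeat

-- Walks

-- Only vertex 0, …, vertex ℓ belong to the walk; the values beyond ℓ are junk.
record Walk {A : Set} (R : A → A → Set) (a b : A) (ℓ : ℕ) : Set where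
  field
    vertex : ℕ → A
    step   : ∀ r → r < ℓ → R (vertex r) (vertex (suc r))
    start  : vertex 0 ≡ a
    end    : vertex ℓ ≡ b

open Walk

ClosedWalk : {A : Set} → (A → A → Set) → ℕ → Set
ClosedWalk R ℓ = ∃ λ a → Walk R a a ℓ

module _ {A : Set} {R : A → A → Set} where

  stay : (a : A) → Walk R a a 0
  stay a = record { vertex = λ _ → a ; step = λ _ () ; start = refl ; end = refl }

  edge : ∀ {a b} → R a b → Walk R a b 1
  edge {a} {b} e = record
    { vertex = λ { zero → a ; (suc _) → b }
    ; step   = λ { zero _ → e ; (suc _) (s≤s ()) }
    ; start  = refl
    ; end    = refl
    }

  infixr 5 _++_

  _++_ : ∀ {a b c ℓ ℓ′} → Walk R a b ℓ → Walk R b c ℓ′ → Walk R a c (ℓ + ℓ′)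
  _++_ {ℓ = ℓ} {ℓ′} W V = record
    { vertex = v
    ; step   = steps
    ; start  = trans (v-≤ z≤n) (start W)
    ; end    = trans (v-≥ (m≤m+n ℓ ℓ′)) (trans (cong (vertex V) (m+n∸m≡n ℓ ℓ′)) (end V))
    }
    where
    v : ℕ → A
    v r with r ≤? ℓ
    ... | yes _ = vertex W r
    ... | no _ = vertex V (r ∸ ℓ)

    v-≤ : ∀ {r} → r ≤ ℓ → v r ≡ vertex W r
    v-≤ {r} r≤ℓ with r ≤? ℓ
    ... | yes _ = refl
    ... | no r≰ℓ = contradiction r≤ℓ r≰ℓ

    v-≥ : ∀ {r} → ℓ ≤ r → v r ≡ vertex V (r ∸ ℓ)
    v-≥ {r} ℓ≤r with r ≤? ℓ
    ... | no _ = refl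
    ... | yes r≤ℓ with ≤-antisym r≤ℓ ℓ≤r
    ...   | refl = trans (end W) (trans (sym (start V)) (cong (vertex V) (sym (n∸n≡0 r))))

    steps : ∀ r → r < ℓ + ℓ′ → R (v r) (v (suc r))
    steps r r<ℓ+ℓ′ with ℓ ≤? r
    ... | no ℓ≰r = subst₂ R (sym (v-≤ (<⇒≤ r<ℓ))) (sym (v-≤ r<ℓ)) (step W r r<ℓ)
      where
      r<ℓ : r < ℓ
      r<ℓ = ≰⇒> ℓ≰r
    ... | yes ℓ≤r = subst₂ R (sym (v-≥ ℓ≤r))
                             (sym (trans (v-≥ (m≤n⇒m≤1+n ℓ≤r)) (cong (vertex V) (+-∸-assoc 1 ℓ≤r))))
                             (step V (r ∸ ℓ) r∸ℓ<ℓ′)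
      where
      r∸ℓ<ℓ′ : r ∸ ℓ < ℓ′
      r∸ℓ<ℓ′ = subst (r ∸ ℓ <_) (m+n∸m≡n ℓ ℓ′) (∸-monoˡ-< r<ℓ+ℓ′ ℓ≤r)

  reverse : Symmetric R → ∀ {a b ℓ} → Walk R a b ℓ → Walk R b a ℓ
  reverse R-sym {ℓ = ℓ} W = record
    { vertex = λ r → vertex W (ℓ ∸ r)
    ; step   = λ r r<ℓ → R-sym (subst (R _) (cong (vertex W) (sym (+-∸-assoc 1 r<ℓ)))
                                 (step W (ℓ ∸ suc r) (∸-monoʳ-< {o = 0} (s≤s z≤n) r<ℓ)))
    ; start  = end W
    ; end    = trans (cong (vertex W) (n∸n≡0 ℓ)) (start W)
    }

  segment : ∀ {a b ℓ} (W : Walk R a b ℓ) {i j} → i ≤ j → j ≤ ℓ → Walk R (vertex W i) (vertex W j) (j ∸ i)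
  segment W {i} {j} i≤j j≤ℓ = record
    { vertex = λ r → vertex W (i + r)
    ; step   = λ r r<j∸i → subst (R _) (cong (vertex W) (sym (+-suc i r)))
                              (step W (i + r) (<-≤-trans (i+r<j r<j∸i) j≤ℓ))
    ; start  = cong (vertex W) (+-identityʳ i)
    ; end    = cong (vertex W) (m+[n∸m]≡n i≤j)
    }
    where
    i+r<j : ∀ {r} → r < j ∸ i → i + r < j
    i+r<j {r} r<j∸i = subst (i + r <_) (m+[n∸m]≡n i≤j) (+-monoʳ-< i r<j∸i)

  infixl 5 _▷_

  _▷_ : ∀ {a b c ℓ} → Walk R a b ℓ → R b c → Walk R a c (suc ℓ)
  _▷_ {ℓ = ℓ} W e = subst (Walk R _ _) (+-comm ℓ 1) (W ++ edge e)

  unsnoc : ∀ {a c ℓ} → Walk R a c (suc ℓ) → ∃[ b ] Walk R a b ℓ × R b c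
  unsnoc {ℓ = ℓ} W =
    vertex W ℓ ,
    record { vertex = vertex W ; step = λ r r<ℓ → step W r (m<n⇒m<1+n r<ℓ)
           ; start = start W ; end = refl } ,
    subst (R _) (end W) (step W ℓ (n<1+n ℓ))

  map : {B : Set} {R′ : B → B → Set} (f : A → B) → (∀ {x y} → R x y → R′ (f x) (f y)) →
        ∀ {a b ℓ} → Walk R a b ℓ → Walk R′ (f a) (f b) ℓ
  map f f-resp W = record
    { vertex = f ∘ vertex W
    ; step   = λ r r<ℓ → f-resp (step W r r<ℓ)
    ; start  = cong f (start W)
    ; end    = cong f (end W)
    }

  splitAtRepeat : ∀ {a L} (W : Walk R a a L) {i j} → i < j → j < L → vertex W i ≡ vertex W j →
                  ∃₂ λ L₁ L₂ → ClosedWalk R L₁ × ClosedWalk R L₂ × L₁ + L₂ ≡ L × L₁ < L × L₂ < L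
  splitAtRepeat {a} {L} W {i} {j} i<j j<L vi≡vj =
    j ∸ i , i + (L ∸ j) , (vertex W j , loop) , (a , rest) , lengths ,
    ≤-<-trans (m∸n≤m j i) j<L ,
    subst (i + (L ∸ j) <_) (m+[n∸m]≡n (<⇒≤ j<L)) (+-monoˡ-< (L ∸ j) i<j)
    where
    loop : Walk R (vertex W j) (vertex W j) (j ∸ i)
    loop = subst (λ x → Walk R x (vertex W j) (j ∸ i)) vi≡vj (segment W (<⇒≤ i<j) (<⇒≤ j<L))

    rest : Walk R a a (i + (L ∸ j))
    rest = subst₂ (λ x y → Walk R x y (i + (L ∸ j))) (start W) (end W)
             (segment W z≤n (<⇒≤ (<-trans i<j j<L)) ++
              subst (λ x → Walk R x (vertex W L) (L ∸ j)) (sym vi≡vj) (segment W (<⇒≤ j<L) ≤-refl))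

    lengths : j ∸ i + (i + (L ∸ j)) ≡ L
    lengths = begin
      j ∸ i + (i + (L ∸ j)) ≡⟨ +-assoc (j ∸ i) i (L ∸ j) ⟨
      j ∸ i + i + (L ∸ j)   ≡⟨ cong (_+ (L ∸ j)) (m∸n+n≡m (<⇒≤ i<j)) ⟩
      j + (L ∸ j)           ≡⟨ m+[n∸m]≡n (<⇒≤ j<L) ⟩
      L                     ∎
      where open ≡-Reasoning

-- Odd cycles and odd closed walks

OddClosedWalkFree : ℕ → ∀ {n} → Graph n → Set
OddClosedWalkFree s G = ∀ {L} → ClosedWalk (Adj G) L → parity L ≡ 1ℙ → L ≤ suc (2 * s) → ⊥

mod-of-toℕ : ∀ {m r} (k : Fin (suc m)) → toℕ k ≡ r → r mod suc m ≡ k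
mod-of-toℕ {m} k refl = Finₚ.toℕ-injective (trans (Finₚ.toℕ-fromℕ< _) (m<n⇒m%n≡m (Finₚ.toℕ<n k)))

mod-self : ∀ m → suc m mod suc m ≡ zero
mod-self m = Finₚ.toℕ-injective (trans (Finₚ.toℕ-fromℕ< _) (n%n≡0 (suc m)))

module _ {n} (G : Graph n) where

  adj? : ∀ a b → Dec (Adj G a b)
  adj? a b = adj G a b Boolₚ.≟ true

  adj-sym : Symmetric (Adj G)
  adj-sym {a} {b} ab = trans (Graph.sym G b a) ab

  adj-irrefl : ∀ {a} → ¬ Adj G a a
  adj-irrefl {a} aa with trans (sym aa) (irrefl G a)
  ... | ()

  walk? : ∀ ℓ a b → Dec (Walk (Adj G) a b ℓ)
  walk? zero a b = map′ (λ { refl → stay a }) (λ W → trans (sym (start W)) (end W)) (a Finₚ.≟ b)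
  walk? (suc ℓ) a b = map′ (λ (v , W , e) → W ▷ e) unsnoc (Finₚ.any? λ v → walk? ℓ a v ×-dec adj? v b)

  cycle⇒closedWalk : ∀ {m} → ContainsCycle G (suc m) → ClosedWalk (Adj G) (suc m)
  cycle⇒closedWalk {m} (f , _ , steps , closing) = f zero , record
    { vertex = λ r → f (r mod suc m)
    ; step   = around
    ; start  = refl
    ; end    = cong f (mod-self m)
    }
    where
    around : ∀ r → r < suc m → Adj G (f (r mod suc m)) (f (suc r mod suc m))
    around r r<L with m≤n⇒m<n∨m≡n (≤-pred r<L)
    ... | inj₁ r<m = subst₂ (Adj G)
                      (cong f (sym (mod-of-toℕ (inject₁ i) (trans (Finₚ.toℕ-inject₁ i) toℕ-i))))
                      (cong f (sym (mod-of-toℕ (suc i) (cong suc toℕ-i))))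
                      (steps i)
      where
      i : Fin m
      i = fromℕ< r<m

      toℕ-i : toℕ i ≡ r
      toℕ-i = Finₚ.toℕ-fromℕ< r<m
    ... | inj₂ refl = subst₂ (Adj G) (cong f (sym (mod-of-toℕ (fromℕ m) (Finₚ.toℕ-fromℕ m))))
                        (cong f (sym (mod-self m))) closing

  closedWalk⇒cycle : ∀ {a m} (W : Walk (Adj G) a a (suc m)) →
                     Injective _≡_ _≡_ (vertex W ∘ toℕ) → ContainsCycle G (suc m)
  closedWalk⇒cycle {m = m} W inj = vertex W ∘ toℕ , inj , steps , closing
    where
    steps : ∀ (i : Fin m) → Adj G (vertex W (toℕ (inject₁ i))) (vertex W (suc (toℕ i)))
    steps i = subst (λ r → Adj G (vertex W r) (vertex W (suc (toℕ i)))) (sym (Finₚ.toℕ-inject₁ i))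
                (step W (toℕ i) (m<n⇒m<1+n (Finₚ.toℕ<n i)))

    closing : Adj G (vertex W (toℕ (fromℕ m))) (vertex W 0)
    closing = subst₂ (Adj G) (cong (vertex W) (sym (Finₚ.toℕ-fromℕ m))) (trans (end W) (sym (start W)))
                (step W m ≤-refl)

  OddCycle≤ : ℕ → Set
  OddCycle≤ L = ∃[ j ] 1 ≤ j × suc (2 * j) ≤ L × ContainsCycle G (suc (2 * j))

  -- At a repeated vertex a closed walk splits into two shorter ones, one of them odd.
  oddClosedWalk⇒oddCycle : ∀ L → ClosedWalk (Adj G) L → parity L ≡ 1ℙ → OddCycle≤ L
  oddClosedWalk⇒oddCycle = <-rec _ shorten
    where
    weaken : ∀ {L′ L} → L′ < L → OddCycle≤ L′ → OddCycle≤ L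
    weaken L′<L (j , 1≤j , len , cyc) = j , 1≤j , ≤-trans len (<⇒≤ L′<L) , cyc

    shorten : ∀ L → (∀ {L′} → L′ < L → ClosedWalk (Adj G) L′ → parity L′ ≡ 1ℙ → OddCycle≤ L′) →
              ClosedWalk (Adj G) L → parity L ≡ 1ℙ → OddCycle≤ L
    shorten (suc m) rec (a , W) odd with injective⊎repeat Finₚ._≟_ (vertex W ∘ toℕ)
    ... | inj₁ inj with parity≡1⇒2*+1 {suc m} odd
    ...   | zero , refl = contradiction (subst₂ (Adj G) (start W) (end W) (step W 0 ≤-refl)) adj-irrefl
    ...   | suc j , refl = suc j , s≤s z≤n , ≤-refl , closedWalk⇒cycle W inj
    shorten (suc m) rec (a , W) odd | inj₂ (i , j , i<j , vi≡vj)
      with splitAtRepeat W i<j (Finₚ.toℕ<n j) vi≡vj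
    ... | L₁ , L₂ , C₁ , C₂ , L₁+L₂≡L , L₁<L , L₂<L
      with parity-+-odd L₁ L₂ (trans (cong parity L₁+L₂≡L) odd)
    ...   | inj₁ odd₁ = weaken L₁<L (rec L₁<L C₁ odd₁)
    ...   | inj₂ odd₂ = weaken L₂<L (rec L₂<L C₂ odd₂)

  oddCycleFree⇒oddClosedWalkFree : ∀ {s} → OddCycleFree s G → OddClosedWalkFree s G
  oddCycleFree⇒oddClosedWalkFree free {L} C odd L≤2s+1 with oddClosedWalk⇒oddCycle L C odd
  ... | j , 1≤j , len , cyc = free j 1≤j (*-cancelˡ-≤ 2 (≤-pred (≤-trans len L≤2s+1))) cyc

  oddClosedWalkFree⇒oddCycleFree : ∀ {s} → OddClosedWalkFree s G → OddCycleFree s G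
  oddClosedWalkFree⇒oddCycleFree free j _ j≤s cyc =
    free (cycle⇒closedWalk cyc) (parity-2*+1 j) (s≤s (*-monoʳ-≤ 2 j≤s))

-- The path 0 — 1 — 2 — ⋯ with a loop at F

data Hop (F : ℕ) : ℕ → ℕ → Set where
  up   : ∀ {x} → Hop F x (suc x)
  down : ∀ {x} → Hop F (suc x) x
  loop : Hop F F F

hop? : ∀ F x y → Dec (Hop F x y)
hop? F x y with y ≟ suc x | x ≟ suc y | (x ≟ F) ×-dec (y ≟ F)
... | yes refl | _ | _ = yes up
... | no _ | yes refl | _ = yes down
... | no _ | no _ | yes (refl , refl) = yes loop
... | no y≢1+x | no x≢1+y | no ¬loop =
  no λ { up → y≢1+x refl ; down → x≢1+y refl ; loop → ¬loop (refl , refl) }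

hop-sym : ∀ {F} → Symmetric (Hop F)
hop-sym up = down
hop-sym down = up
hop-sym loop = loop

hop-refl : ∀ {F x} → Hop F x x → x ≡ F
hop-refl loop = refl

hop-≤ : ∀ {F x y} → Hop F x y → y ≤ suc x
hop-≤ up = ≤-refl
hop-≤ down = m≤n⇒m≤1+n (n≤1+n _)
hop-≤ loop = n≤1+n _

hop-loop⊎flip : ∀ {F x y} → Hop F x y → (x ≡ F × y ≡ F) ⊎ parity y ≡ parity x ℙ.⁻¹
hop-loop⊎flip {x = x} up = inj₂ (parity-suc x)
hop-loop⊎flip {y = y} down = inj₂ (sym (ℙₚ.suc-homo-⁻¹ y))
hop-loop⊎flip loop = inj₁ (refl , refl)

hopWalk-≤ : ∀ {F a b ℓ} → Walk (Hop F) a b ℓ → b ≤ ℓ + a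
hopWalk-≤ {ℓ = zero} W = ≤-reflexive (trans (sym (end W)) (start W))
hopWalk-≤ {ℓ = suc ℓ} W with unsnoc W
... | _ , W′ , h = ≤-trans (hop-≤ h) (s≤s (hopWalk-≤ W′))

parity-alternating : ∀ (v : ℕ → ℕ) ℓ → (∀ r → r < ℓ → parity (v (suc r)) ≡ parity (v r) ℙ.⁻¹) →
                     parity (v ℓ) ≡ parity (ℓ + v 0)
parity-alternating v zero _ = refl
parity-alternating v (suc ℓ) flips = begin
  parity (v (suc ℓ))      ≡⟨ flips ℓ (n<1+n ℓ) ⟩
  parity (v ℓ) ℙ.⁻¹        ≡⟨ cong ℙ._⁻¹ (parity-alternating v ℓ (λ r r<ℓ → flips r (m<n⇒m<1+n r<ℓ))) ⟩
  parity (ℓ + v 0) ℙ.⁻¹    ≡⟨ parity-suc (ℓ + v 0) ⟨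
  parity (suc ℓ + v 0)    ∎
  where open ≡-Reasoning

-- Going around the loop at F and back to x ≤ 1 takes at least 2F − 1 steps; shorter closed
-- walks stay on the path, where every step flips the parity.
closedHopWalk-even : ∀ {F x L} → Walk (Hop F) x x L → x ≤ 1 → suc L < 2 * F → parity L ≡ 0ℙ
closedHopWalk-even {F} {x} {L} W x≤1 short = ℙₚ.+-cancelʳ-≡ (parity x) (parity L) 0ℙ around
  where
  flips : ∀ r → r < L → parity (vertex W (suc r)) ≡ parity (vertex W r) ℙ.⁻¹
  flips r r<L with hop-loop⊎flip (step W r r<L)
  ... | inj₂ flip = flip
  ... | inj₁ (vr≡F , vr+1≡F) = contradiction 2F≤1+L (<⇒≱ short)
    where
    F≤before : F ≤ r + x
    F≤before = subst₂ _≤_ vr≡F (cong (r +_) (start W))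
                 (hopWalk-≤ (segment W z≤n (<⇒≤ r<L)))
    F≤after : F ≤ (L ∸ suc r) + x
    F≤after = subst₂ _≤_ vr+1≡F (cong (L ∸ suc r +_) (end W))
                (hopWalk-≤ (reverse hop-sym (segment W r<L ≤-refl)))

    2F≤1+L : 2 * F ≤ suc L
    2F≤1+L = begin
      2 * F                            ≡⟨ cong (F +_) (+-identityʳ F) ⟩
      F + F                            ≤⟨ +-mono-≤ F≤before F≤after ⟩
      (r + x) + ((L ∸ suc r) + x)      ≤⟨ +-mono-≤ (+-monoʳ-≤ r x≤1) (+-monoʳ-≤ (L ∸ suc r) x≤1) ⟩
      (r + 1) + ((L ∸ suc r) + 1)      ≡⟨ cong (_+ ((L ∸ suc r) + 1)) (+-comm r 1) ⟩
      suc r + ((L ∸ suc r) + 1)        ≡⟨ +-assoc (suc r) (L ∸ suc r) 1 ⟨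
      suc r + (L ∸ suc r) + 1          ≡⟨ cong (_+ 1) (m+[n∸m]≡n r<L) ⟩
      L + 1                            ≡⟨ +-comm L 1 ⟩
      suc L                            ∎
      where open ≤-Reasoning

  around : parity L ℙ.+ parity x ≡ parity x
  around = begin
    parity L ℙ.+ parity x    ≡⟨ ℙₚ.+-homo-+ L x ⟨
    parity (L + x)           ≡⟨ cong (λ y → parity (L + y)) (start W) ⟨
    parity (L + vertex W 0)  ≡⟨ parity-alternating (vertex W) L flips ⟨
    parity (vertex W L)      ≡⟨ cong parity (end W) ⟩
    parity x                 ∎
    where open ≡-Reasoning

∣-1∣-up : ∀ {F} x → Hop F ∣ x - 1 ∣ ∣ suc x - 1 ∣
∣-1∣-up zero = down
∣-1∣-up (suc zero) = up
∣-1∣-up (suc (suc x)) = up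

∣-1∣-hop : ∀ {F x y} → Hop (suc F) x y → Hop F ∣ x - 1 ∣ ∣ y - 1 ∣
∣-1∣-hop (up {x}) = ∣-1∣-up x
∣-1∣-hop (down {x}) = hop-sym (∣-1∣-up x)
∣-1∣-hop {F} loop = subst (λ z → Hop F z z) (sym (∣-∣-identityʳ F)) loop

∣-1∣-≤ : ∀ {F x} → 1 ≤ F → x ≤ suc F → ∣ x - 1 ∣ ≤ F
∣-1∣-≤ {x = zero} 1≤F _ = 1≤F
∣-1∣-≤ {x = suc x} _ x<F = subst (_≤ _) (sym (∣-∣-identityʳ x)) (≤-pred x<F)

∣-1∣-≤1 : ∀ {x} → x ≤ 2 → ∣ x - 1 ∣ ≤ 1
∣-1∣-≤1 {zero} _ = ≤-refl
∣-1∣-≤1 {suc zero} _ = z≤n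
∣-1∣-≤1 {suc (suc zero)} _ = ≤-refl
∣-1∣-≤1 {suc (suc (suc _))} (s≤s (s≤s ()))

module TruncatedDistance {n} (G : Graph n) (s : ℕ) where

  dist : Fin n → Fin n → ℕ
  dist x u = least (λ ℓ → walk? G ℓ x u) (suc s)

  dist-≤ : ∀ x u → dist x u ≤ suc s
  dist-≤ x u = least-≤-bound (λ ℓ → walk? G ℓ x u) (suc s)

  dist-walk : ∀ {x u} → dist x u < suc s → Walk (Adj G) x u (dist x u)
  dist-walk {x} {u} = least-holds (λ ℓ → walk? G ℓ x u) (suc s)

  dist-least : ∀ {x u ℓ} → Walk (Adj G) x u ℓ → dist x u ≤ ℓ
  dist-least {x} {u} = least-≤ (λ ℓ → walk? G ℓ x u) (suc s)

  dist-lipschitz : ∀ {x a b} → Adj G a b → dist x b ≤ suc (dist x a)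
  dist-lipschitz {x} {a} {b} ab with m≤n⇒m<n∨m≡n (dist-≤ x a)
  ... | inj₁ a<cap = dist-least (dist-walk a<cap ▷ ab)
  ... | inj₂ a≡cap = ≤-trans (dist-≤ x b) (≤-trans (≤-reflexive (sym a≡cap)) (n≤1+n _))

  -- Adjacent vertices at the same distance d ≤ s from x close an odd walk of length 2d + 1.
  dist-hop : OddClosedWalkFree s G → ∀ {x a b} → Adj G a b → Hop (suc s) (dist x a) (dist x b)
  dist-hop free {x} {a} {b} ab with <-cmp (dist x a) (dist x b)
  ... | tri< a<b _ _ = subst (Hop _ _) (≤-antisym a<b (dist-lipschitz ab)) up
  ... | tri> _ _ b<a = subst (λ y → Hop _ y _) (≤-antisym b<a (dist-lipschitz (adj-sym G ab))) down
  ... | tri≈ _ a≡b _ with m≤n⇒m<n∨m≡n (dist-≤ x a)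
  ...   | inj₂ a≡cap = subst₂ (Hop _) (sym a≡cap) (sym (trans (sym a≡b) a≡cap)) loop
  ...   | inj₁ a<cap =
    contradiction (s≤s (*-monoʳ-≤ 2 (≤-pred a<cap))) (free (x , oddWalk) (parity-2*+1 d))
    where
    d : ℕ
    d = dist x a

    toB : Walk (Adj G) x b d
    toB = subst (Walk (Adj G) x b) (sym a≡b) (dist-walk (subst (_< suc s) a≡b a<cap))

    oddWalk : Walk (Adj G) x x (suc (2 * d))
    oddWalk = subst (Walk (Adj G) x x) (trans (+-suc d d) (cong (λ e → suc (d + e)) (sym (+-identityʳ d))))
                    (dist-walk a<cap ++ edge ab ++ reverse (adj-sym G) toB)

  -- Folding at 1 gives every vertex within distance 2 of x a label ≤ 1, while the labels
  -- still take only the t + 3 values 0, …, t + 2 (for s = t + 2).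
  label : Fin n → Fin n → ℕ
  label x u = ∣ dist x u - 1 ∣

  label-hop : OddClosedWalkFree s G → ∀ {x a b} → Adj G a b → Hop s (label x a) (label x b)
  label-hop free {x} ab = ∣-1∣-hop (dist-hop free {x} ab)

  label-≤ : 1 ≤ s → ∀ x u → label x u ≤ s
  label-≤ 1≤s x u = ∣-1∣-≤ 1≤s (dist-≤ x u)

module _ {m} {R : Fin m → Fin m → Set} (R? : ∀ i j → Dec (R i j))
         (R-sym : Symmetric R) (R-irrefl : ∀ {i} → ¬ R i i) where

  decGraph : Graph m
  decGraph = record
    { adj    = λ i j → does (R? i j)
    ; sym    = λ i j → does-⇔ (mk⇔ R-sym R-sym) (R? i j) (R? j i)
    ; irrefl = λ i → dec-false (R? i i) R-irrefl
    }

  decGraph-adj : ∀ {i j} → Adj decGraph i j → R i j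
  decGraph-adj {i} {j} ij with R? i j | ij
  ... | yes r | _ = r
  ... | no _ | ()

  decGraph-adj⁻ : ∀ {i j} → R i j → Adj decGraph i j
  decGraph-adj⁻ {i} {j} = dec-true (R? i j)

-- The target graph Γ

module LabelGraph (t k : ℕ) where

  F : ℕ
  F = t + 2

  Labels : Set
  Labels = Fin k → Fin (suc F)

  Anchored : Labels → Set
  Anchored x = ∃[ i ] toℕ (x i) ≤ 1

  record Linked (x y : Labels) : Set where
    constructor linked
    field
      anchoredˡ : Anchored x
      anchoredʳ : Anchored y
      hops      : ∀ i → Hop F (toℕ (x i)) (toℕ (y i))

  linked? : ∀ x y → Dec (Linked x y)
  linked? x y = map′ (λ (ax , ay , hs) → linked ax ay hs) (λ (linked ax ay hs) → ax , ay , hs)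
    (Finₚ.any? (λ i → toℕ (x i) ≤? 1) ×-dec Finₚ.any? (λ i → toℕ (y i) ≤? 1)
     ×-dec Finₚ.all? (λ i → hop? F (toℕ (x i)) (toℕ (y i))))

  linked-sym : Symmetric Linked
  linked-sym (linked ax ay hs) = linked ay ax (hop-sym ∘ hs)

  linked-irrefl : ∀ {x} → ¬ Linked x x
  linked-irrefl (linked (i , xi≤1) _ hs) =
    contradiction (≤-trans (m≤n+m 2 t) (subst (_≤ 1) (hop-refl (hs i)) xi≤1)) λ { (s≤s ()) }

  linked-cong : ∀ {x x′ y y′} → x ≗ x′ → y ≗ y′ → Linked x y → Linked x′ y′
  linked-cong x≗x′ y≗y′ (linked (i , xi≤1) (j , yj≤1) hs) = linked
    (i , subst (λ v → toℕ v ≤ 1) (x≗x′ i) xi≤1)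
    (j , subst (λ v → toℕ v ≤ 1) (y≗y′ j) yj≤1)
    (λ l → subst₂ (λ u v → Hop F (toℕ u) (toℕ v)) (x≗x′ l) (y≗y′ l) (hs l))

  Γ-linked? : ∀ x y → Dec (Linked (finToFun x) (finToFun y))
  Γ-linked? x y = linked? (finToFun x) (finToFun y)

  Γ : Graph (suc F ^ k)
  Γ = decGraph Γ-linked? linked-sym linked-irrefl

  Γ-adj : ∀ {x y} → Adj Γ x y → Linked (finToFun x) (finToFun y)
  Γ-adj = decGraph-adj Γ-linked? linked-sym linked-irrefl

  linked⇒homomorphic : ∀ {n} (G : Graph n) (lab : Fin n → Labels) →
                       (∀ {a b} → Adj G a b → Linked (lab a) (lab b)) → Homomorphic G Γ
  linked⇒homomorphic G lab lab-linked = funToFin ∘ lab , λ a b ab →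
    decGraph-adj⁻ Γ-linked? linked-sym linked-irrefl
      (linked-cong (sym ∘ Finₚ.finToFun-funToFin (lab a)) (sym ∘ Finₚ.finToFun-funToFin (lab b))
                   (lab-linked ab))

  -- Along a coordinate that is ≤ 1 at the start, an odd closed walk of length ≤ 2t + 1 in Γ
  -- becomes one in Hop F.
  Γ-oddClosedWalkFree : OddClosedWalkFree t Γ
  Γ-oddClosedWalkFree {zero} _ () _
  Γ-oddClosedWalkFree {suc L} (a , W) odd L≤2t+1 =
    contradiction (trans (sym even) odd) λ ()
    where
    first : Linked (finToFun (vertex W 0)) (finToFun (vertex W 1))
    first = Γ-adj (step W 0 (s≤s z≤n))

    i : Fin k
    i = proj₁ (Linked.anchoredˡ first)

    coordinate : Fin (suc F ^ k) → ℕ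
    coordinate x = toℕ (finToFun x i)

    short : suc (suc L) < 2 * F
    short = begin-strict
      suc (suc L)     ≤⟨ s≤s L≤2t+1 ⟩
      2 + 2 * t       <⟨ n≤1+n _ ⟩
      4 + 2 * t       ≡⟨ +-comm 4 (2 * t) ⟩
      2 * t + 2 * 2   ≡⟨ *-distribˡ-+ 2 t 2 ⟨
      2 * F           ∎
      where open ≤-Reasoning

    even : parity (suc L) ≡ 0ℙ
    even = closedHopWalk-even (map coordinate (λ xy → Linked.hops (Γ-adj xy) i) W)
             (subst (λ v → coordinate v ≤ 1) (start W) (proj₂ (Linked.anchoredˡ first)))
             short

  Γ-oddCycleFree : OddCycleFree t Γ
  Γ-oddCycleFree = oddClosedWalkFree⇒oddCycleFree Γ Γ-oddClosedWalkFree

-- Packing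

module _ {A : Set} {Near : A → A → Set} (near? : ∀ a b → Dec (Near a b)) where

  pack : List A → List A
  pack [] = []
  pack (u ∷ us) with Any.any? (λ v → near? v u) (pack us)
  ... | yes _ = pack us
  ... | no _ = u ∷ pack us

  pack-separated : ∀ us → AllPairs (λ u v → ¬ Near v u) (pack us)
  pack-separated [] = []
  pack-separated (u ∷ us) with Any.any? (λ v → near? v u) (pack us)
  ... | yes _ = pack-separated us
  ... | no far = ¬Any⇒All¬ (pack us) far ∷ pack-separated us

  pack-covers : (∀ {u} → Near u u) → ∀ {u} us → u ∈ us → Any (λ v → Near v u) (pack us)
  pack-covers near-refl (u ∷ us) (here refl) with Any.any? (λ v → near? v u) (pack us)
  ... | yes near = near
  ... | no _ = here near-refl
  pack-covers near-refl (u′ ∷ us) (there u∈us) with Any.any? (λ v → near? v u′) (pack us)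
  ... | yes _ = pack-covers near-refl us u∈us
  ... | no _ = there (pack-covers near-refl us u∈us)

module _ {A : Set} where

  sum-map-zero : ∀ (f : A → ℕ) {xs} → All (λ a → f a ≡ 0) xs → sum (List.map f xs) ≡ 0
  sum-map-zero f [] = refl
  sum-map-zero f (fx≡0 ∷ fxs≡0) = cong₂ _+_ fx≡0 (sum-map-zero f fxs≡0)

  sum-map-+ : ∀ (f g : A → ℕ) xs →
              sum (List.map (λ a → f a + g a) xs) ≡ sum (List.map f xs) + sum (List.map g xs)
  sum-map-+ f g [] = refl
  sum-map-+ f g (x ∷ xs) = trans (cong (f x + g x +_) (sum-map-+ f g xs)) (+-interchange (f x) (g x) _ _)

  sum-map-≤-length : ∀ (f : A → ℕ) → (∀ a → f a ≤ 1) → ∀ xs → sum (List.map f xs) ≤ length xs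
  sum-map-≤-length f f≤1 [] = z≤n
  sum-map-≤-length f f≤1 (x ∷ xs) = +-mono-≤ (f≤1 x) (sum-map-≤-length f f≤1 xs)

module _ {n} (G : Graph n) where

  indicator : Fin n → Fin n → ℕ
  indicator v x = if adj G v x then 1 else 0

  NoCommonNeighbour : Fin n → Fin n → Set
  NoCommonNeighbour v w = ∀ {x} → Adj G v x → Adj G w x → ⊥

  neighboursIn : List (Fin n) → Fin n → ℕ
  neighboursIn S x = sum (List.map (λ v → indicator v x) S)

  neighboursIn-≤1 : ∀ {S} → AllPairs NoCommonNeighbour S → ∀ x → neighboursIn S x ≤ 1
  neighboursIn-≤1 {[]} [] x = z≤n
  neighboursIn-≤1 {v ∷ S} (v-sep ∷ sep) x with adj G v x in vx
  ... | false = neighboursIn-≤1 sep x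
  ... | true = s≤s (≤-reflexive (sum-map-zero (λ w → indicator w x) (All.map absent v-sep)))
    where
    absent : ∀ {w} → NoCommonNeighbour v w → indicator w x ≡ 0
    absent {w} v≁w with adj G w x in wx
    ... | true = ⊥-elim (v≁w vx wx)
    ... | false = refl

  sum-degree≡sum-neighboursIn : ∀ S →
    sum (List.map (degree G) S) ≡ sum (List.map (neighboursIn S) (allFin n))
  sum-degree≡sum-neighboursIn [] = sym (sum-map-zero (λ _ → 0) (All.universal (λ _ → refl) (allFin n)))
  sum-degree≡sum-neighboursIn (v ∷ S) =
    trans (cong (degree G v +_) (sum-degree≡sum-neighboursIn S))
          (sym (sum-map-+ (indicator v) (neighboursIn S) (allFin n)))

  noCommonNeighbour⇒sum-degree≤ : ∀ {S} → AllPairs NoCommonNeighbour S → sum (List.map (degree G) S) ≤ n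
  noCommonNeighbour⇒sum-degree≤ {S} sep = begin
    sum (List.map (degree G) S)                ≡⟨ sum-degree≡sum-neighboursIn S ⟩
    sum (List.map (neighboursIn S) (allFin n)) ≤⟨ sum-map-≤-length _ (neighboursIn-≤1 sep) (allFin n) ⟩
    length (allFin n)                          ≡⟨ length-tabulate id ⟩
    n                                          ∎
    where open ≤-Reasoning

  noCommonNeighbour⇒length*p≤q : ∀ {p q S} → (∀ v → p * n ≤ q * degree G v) →
                                 AllPairs NoCommonNeighbour S → length S * p ≤ q
  noCommonNeighbour⇒length*p≤q {S = []} _ _ = z≤n
  noCommonNeighbour⇒length*p≤q {p} {q} {S@(v ∷ _)} minDegree sep =
    *-cancelʳ-≤ (length S * p) q n {{Finₚ.nonZeroIndex v}} (begin
      length S * p * n                 ≡⟨ *-assoc (length S) p n ⟩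
      length S * (p * n)               ≤⟨ degrees S ⟩
      q * sum (List.map (degree G) S)  ≤⟨ *-monoʳ-≤ q (noCommonNeighbour⇒sum-degree≤ sep) ⟩
      q * n                            ∎)
    where
    open ≤-Reasoning

    degrees : ∀ S → length S * (p * n) ≤ q * sum (List.map (degree G) S)
    degrees [] = z≤n
    degrees (v ∷ S) = subst (p * n + length S * (p * n) ≤_) (sym (*-distribˡ-+ q (degree G v) _))
                        (+-mono-≤ (minDegree v) (degrees S))

module Construction {n} (G : Graph n) (t : ℕ) (free : OddCycleFree (t + 2) G) where

  open TruncatedDistance G (t + 2)

  near? : ∀ x u → Dec (dist x u ≤ 2)
  near? x u = dist x u ≤? 2

  centres : List (Fin n)
  centres = pack near? (allFin n)

  k : ℕ
  k = length centres

  open LabelGraph t k public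

  centres-noCommonNeighbour : AllPairs (NoCommonNeighbour G) centres
  centres-noCommonNeighbour = AllPairs.map common⇒near (pack-separated near? (allFin n))
    where
    common⇒near : ∀ {v w} → ¬ dist w v ≤ 2 → NoCommonNeighbour G v w
    common⇒near far vx wx = far (dist-least (edge wx ++ edge (adj-sym G vx)))

  labelling : Fin n → Labels
  labelling u i = fromℕ< (s≤s (label-≤ (<⇒≤ (m≤n+m 2 t)) (lookup centres i) u))

  labelling-coordinate : ∀ u i → toℕ (labelling u i) ≡ label (lookup centres i) u
  labelling-coordinate u i = Finₚ.toℕ-fromℕ< _

  labelling-anchored : ∀ u → Anchored (labelling u)
  labelling-anchored u =
    i , subst (_≤ 1) (sym (labelling-coordinate u i)) (∣-1∣-≤1 (lookup-index covered))
    where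
    covered : Any (λ v → dist v u ≤ 2) centres
    covered = pack-covers near? (λ {v} → ≤-trans (dist-least (stay v)) z≤n) (allFin n) (∈-allFin u)

    i : Fin k
    i = Any.index covered

  homomorphic : Homomorphic G Γ
  homomorphic = linked⇒homomorphic G labelling λ {a} {b} ab → linked
    (labelling-anchored a) (labelling-anchored b)
    (λ i → subst₂ (Hop F) (sym (labelling-coordinate a i)) (sym (labelling-coordinate b i))
             (label-hop (oddCycleFree⇒oddClosedWalkFree G free) {lookup centres i} ab))

size-bound : ∀ {t k p q} → 1 ≤ t → k * p ≤ q → (suc (t + 2) ^ k) ^ p ≤ suc t ^ (2 * q)
size-bound {t} {k} {p} {q} 1≤t kp≤q = begin
  (suc (t + 2) ^ k) ^ p  ≡⟨ ^-*-assoc (suc (t + 2)) k p ⟩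
  suc (t + 2) ^ (k * p)  ≤⟨ ^-monoʳ-≤ (suc (t + 2)) kp≤q ⟩
  suc (t + 2) ^ q        ≤⟨ ^-monoˡ-≤ q t+3≤[t+1]² ⟩
  (suc t ^ 2) ^ q        ≡⟨ ^-*-assoc (suc t) 2 q ⟩
  suc t ^ (2 * q)        ∎
  where
  open ≤-Reasoning

  t+3≤[t+1]² : suc (t + 2) ≤ suc t ^ 2
  t+3≤[t+1]² = begin
    suc t + 2       ≤⟨ +-monoʳ-≤ (suc t) (s≤s 1≤t) ⟩
    suc t + suc t   ≡⟨ cong (suc t +_) (+-identityʳ (suc t)) ⟨
    2 * suc t       ≤⟨ *-monoˡ-≤ (suc t) (s≤s 1≤t) ⟩
    suc t * suc t   ≡⟨ cong (suc t *_) (*-identityʳ (suc t)) ⟨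
    suc t ^ 2       ∎

theorem1p3 : (t : ℕ) → 1 ≤ t →
    -- δ = p / q with p, q ≥ 1
    (p q : ℕ) → 1 ≤ p → 1 ≤ q →
    (n : ℕ) (G : Graph n) →
    OddCycleFree (t + 2) G →
    (∀ v → p * n ≤ q * degree G v) →
    Σ ℕ λ m → Σ (Graph m) λ Γ →
      OddCycleFree t Γ × Homomorphic G Γ × (m ^ p ≤ (suc t) ^ (2 * q))
theorem1p3 t 1≤t p q _ _ n G free minDegree =
  suc F ^ k , Γ , Γ-oddCycleFree , homomorphic ,
  size-bound {t} {k} {p} {q} 1≤t
    (noCommonNeighbour⇒length*p≤q G {p} {q} minDegree centres-noCommonNeighbour)
  where open Construction G t free
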